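{- Let $\Sigma$ be an action signature, $\alpha$ a simple action of $\mathcal L(\Sigma)$, $C\subseteq$ Agents, $\varphi$ a sentence, $\mathbf S$ a state model and $s\in S$. Then $s\in[\![\langle\alpha\rangle\Diamond^*_C\varphi]\!]_{\mathbf S}$ iff there exist $k\ge0$, agents $A_1,\dots,A_k\in C$, a sequence of states $s=s_0\to_{A_1}s_1\to_{A_2}\cdots\to_{A_k}s_k$ in $\mathbf S$, and a sequence of simple actions $\alpha=\alpha_0\to_{A_1}\alpha_1\to_{A_2}\cdots\to_{A_k}\alpha_k$ in $\Omega$, such that $s_i\in[\![\mathrm{Pre}(\alpha_i)]\!]_{\mathbf S}$ for all $0\le i<k$ and $s_k\in[\![\langle\alpha_k\rangle\varphi]\!]_{\mathbf S}$.
   Context: Fix AtSen and Agents. A state model is $\mathbf S=(S,(\to_A)_{A\in\mathrm{Agents}},\|\cdot\|)$. An action signature $\Sigma$: a finite set with relations $\to_A$ and an enumeration $\sigma_1,\dots,\sigma_n$. $\mathcal L(\Sigma)$: sentences $\mathsf{true}\mid p\mid\neg\varphi\mid\varphi\wedge\psi\mid\Box_A\varphi\mid\Box^*_B\varphi\mid[\pi]\varphi$; programs $\mathsf{skip}\mid\mathsf{crash}\mid\sigma_i\psi_1\cdots\psi_n\mid\pi\cup\rho\mid\pi;\rho\mid\pi^*$. Semantics: $\Box_A$ via $\to_A$; $\Box^*_B$ via the reflexive-transitive closure of $\bigcup_{A\in B}\to_A$; $\Diamond^*_C=\neg\Box^*_C\neg$, $\langle\pi\rangle=\neg[\pi]\neg$.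 Each program gives for every $\mathbf S$ a model $\mathbf S(\pi)$ and relation $\pi_{\mathbf S}\subseteq S\times S(\pi)$; $s\in[\![[\pi]\varphi]\!]_{\mathbf S}$ iff all $\pi_{\mathbf S}$-successors of $s$ satisfy $\varphi$ in $\mathbf S(\pi)$. $\mathsf{skip}$: identity; $\mathsf{crash}$: empty; $\sigma_i\vec\psi$: states $(s,\sigma_j)$ with $s\in[\![\psi_j]\!]_{\mathbf S}$, $(s,\sigma_j)\to_A(t,\sigma_k)$ iff $s\to_A t$ and $\sigma_j\to_A\sigma_k$, valuation inherited from $s$, relation $s\mapsto(s,\sigma_i)$ for $s\in[\![\psi_i]\!]_{\mathbf S}$; $;$ composes model transformations and relations; $\cup$ is disjoint union; $\pi^*$ the union of iterates. Simple actions: programs without $\cup$ and $*$. $\Omega$: simple actions with the smallest relations $\to_A$ such that $\mathsf{skip}\to_A\mathsf{skip}$, $\sigma_i\vec\varphi\to_A\sigma_j\vec\psi$ iff $\sigma_i\to_A\sigma_j$ in $\Sigma$ and $\vec\varphi=\vec\psi$, and $\alpha;\beta\to_A\alpha';\beta'$ whenever $\alpha\to_A\alpha'$, $\beta\to_A\beta'$. $\mathrm{Pre}(\mathsf{skip})=\mathsf{true}$, $\mathrm{Pre}(\mathsf{crash})=\mathsf{false}$, $\mathrm{Pre}(\sigma_i\vec\psi)=\psi_i$, $\mathrm{Pre}(\alpha;\beta)=\langle\alpha\rangle\mathrm{Pre}(\beta)$. -}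

module Defs where

open import Level using (0ℓ)
open import Data.Nat using (ℕ; zero; suc)
open import Data.Fin using (Fin; zero; suc)
open import Data.Vec using (Vec; []; _∷_; lookup)
open import Data.Empty using (⊥)
open import Data.Unit using (⊤)
open import Data.Product using (Σ; _×_; _,_; proj₁; proj₂)
open import Data.Sum using (_⊎_; inj₁; inj₂; [_,_]′)
open import Data.Sum.Relation.Binary.Pointwise using (Pointwise)
open import Relation.Nullary using (¬_)
open import Relation.Binary.PropositionalEquality using (_≡_)
open import Relation.Binary.Construct.Closure.ReflexiveTransitive using (Star)

-- An action signature over a type of agents: a finite set of action
-- types enumerated as σ₁,…,σₙ (here Fin n) with relations →_A.
record Signature (Agents : Set) : Set₁ where
  field
    size : ℕ
    _⟶[_]_ : Fin size → Agents → Fin size → Set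

module Logic (AtSen Agents : Set) (Sig : Signature Agents) where

  open Signature Sig

  record Model : Set₁ where
    field
      St : Set
      R  : Agents → St → St → Set
      V  : AtSen → St → Set
  open Model public

  _⊕_ : Model → Model → Model
  St (M ⊕ N) = St M ⊎ St N
  R (M ⊕ N) A = Pointwise (R M A) (R N A)
  V (M ⊕ N) p = [ V M p , V N p ]′

  data ⨆R (F : ℕ → Model) (A : Agents) : Σ ℕ (λ i → St (F i)) → Σ ℕ (λ i → St (F i)) → Set where
    within : ∀ {i x y} → R (F i) A x y → ⨆R F A (i , x) (i , y)

  ⨆ : (ℕ → Model) → Model
  St (⨆ F) = Σ ℕ (λ i → St (F i))
  R (⨆ F) = ⨆R F
  V (⨆ F) p x = V (F (proj₁ x)) p (proj₂ x)

  empty : Model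
  St empty = ⊥
  R empty _ _ _ = ⊥
  V empty _ _ = ⊥

  reach : (M : Model) → (Agents → Set) → St M → St M → Set
  reach M B s t = Σ Agents (λ A → B A × R M A s t)

  infixr 6 _∧ˢ_
  infix 7 ¬ˢ_
  infixr 5 _∪_
  infixr 6 _⨾_

  -- Syntax of L(Σ); subsets B ⊆ Agents are predicates Agents → Set
  data Sentence : Set₁
  data Program : Set₁

  data Sentence where
    true : Sentence
    atom : AtSen → Sentence
    ¬ˢ_ : Sentence → Sentence
    _∧ˢ_ : Sentence → Sentence → Sentence
    □ : Agents → Sentence → Sentence
    □* : (Agents → Set) → Sentence → Sentence
    [_]_ : Program → Sentence → Sentence

  data Program where
    skip crash : Program
    act : Fin size → Vec Sentence size → Program
    _∪_ _⨾_ : Program → Program → Program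
    _* : Program → Program

  ⟦_⟧ : Sentence → (M : Model) → St M → Set
  ⟦_⟧ⱽ : ∀ {m} → Vec Sentence m → (M : Model) → Fin m → St M → Set
  _⟪_⟫ : Model → Program → Model
  rel : (π : Program) (M : Model) → St M → St (M ⟪ π ⟫) → Set
  iterM : Program → ℕ → Model → Model
  iterRel : (π : Program) (k : ℕ) (M : Model) → St M → St (iterM π k M) → Set

  ⟦ true ⟧ M s = ⊤
  ⟦ atom p ⟧ M s = V M p s
  ⟦ ¬ˢ φ ⟧ M s = ¬ ⟦ φ ⟧ M s
  ⟦ φ ∧ˢ ψ ⟧ M s = ⟦ φ ⟧ M s × ⟦ ψ ⟧ M s
  ⟦ □ A φ ⟧ M s = ∀ t → R M A s t → ⟦ φ ⟧ M t
  ⟦ □* B φ ⟧ M s = ∀ t → Star (reach M B) s t → ⟦ φ ⟧ M t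
  ⟦ [ π ] φ ⟧ M s = ∀ t → rel π M s t → ⟦ φ ⟧ (M ⟪ π ⟫) t

  ⟦ φ ∷ φs ⟧ⱽ M zero s = ⟦ φ ⟧ M s
  ⟦ φ ∷ φs ⟧ⱽ M (suc j) s = ⟦ φs ⟧ⱽ M j s

  M ⟪ skip ⟫ = M
  M ⟪ crash ⟫ = empty
  M ⟪ act i ψs ⟫ = record
    { St = Σ (St M × Fin size) (λ x → ⟦ ψs ⟧ⱽ M (proj₂ x) (proj₁ x))
    ; R = λ A x y → R M A (proj₁ (proj₁ x)) (proj₁ (proj₁ y))
                    × (proj₂ (proj₁ x) ⟶[ A ] proj₂ (proj₁ y))
    ; V = λ p x → V M p (proj₁ (proj₁ x))
    }
  M ⟪ π ∪ ρ ⟫ = (M ⟪ π ⟫) ⊕ (M ⟪ ρ ⟫)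
  M ⟪ π ⨾ ρ ⟫ = (M ⟪ π ⟫) ⟪ ρ ⟫
  M ⟪ π * ⟫ = ⨆ (λ k → iterM π k M)

  rel skip M s t = t ≡ s
  rel crash M s t = ⊥
  rel (act i ψs) M s x = proj₁ (proj₁ x) ≡ s × proj₂ (proj₁ x) ≡ i
  rel (π ∪ ρ) M s = [ rel π M s , rel ρ M s ]′
  rel (π ⨾ ρ) M s u = Σ (St (M ⟪ π ⟫)) (λ t → rel π M s t × rel ρ (M ⟪ π ⟫) t u)
  rel (π *) M s x = iterRel π (proj₁ x) M s (proj₂ x)

  iterM π zero M = M
  iterM π (suc k) M = (iterM π k M) ⟪ π ⟫

  iterRel π zero M s t = t ≡ s
  iterRel π (suc k) M s t =
    Σ (St (iterM π k M)) (λ u → iterRel π k M s u × rel π (iterM π k M) u t)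

  false : Sentence
  false = ¬ˢ true

  ◇* : (Agents → Set) → Sentence → Sentence
  ◇* C φ = ¬ˢ □* C (¬ˢ φ)

  ⟨_⟩_ : Program → Sentence → Sentence
  ⟨ π ⟩ φ = ¬ˢ [ π ] (¬ˢ φ)

  data SAction : Set₁ where
    skip crash : SAction
    act : Fin size → Vec Sentence size → SAction
    _⨾_ : SAction → SAction → SAction

  ⌜_⌝ : SAction → Program
  ⌜ skip ⌝ = skip
  ⌜ crash ⌝ = crash
  ⌜ act i ψs ⌝ = act i ψs
  ⌜ α ⨾ β ⌝ = ⌜ α ⌝ ⨾ ⌜ β ⌝

  data _⟶Ω[_]_ : SAction → Agents → SAction → Set₁ where
    skip : ∀ {A} → skip ⟶Ω[ A ] skip
    act : ∀ {A i j ψs} → i ⟶[ A ] j → act i ψs ⟶Ω[ A ] act j ψs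
    seq : ∀ {A α α′ β β′} → α ⟶Ω[ A ] α′ → β ⟶Ω[ A ] β′ → (α ⨾ β) ⟶Ω[ A ] (α′ ⨾ β′)

  Pre : SAction → Sentence
  Pre skip = true
  Pre crash = false
  Pre (act i ψs) = lookup ψs i
  Pre (α ⨾ β) = ⟨ ⌜ α ⌝ ⟩ Pre β

-- A successor of (s, α) in the updated model M⟪α⟫ along an agent A is again a pair (s′, α′)
-- with s →A s′ in M and α →A α′ in Ω, and conversely every such pair of steps whose source
-- satisfies Pre α is realised in M⟪α⟫.  Following a ◇*_C path in M⟪α⟫ from an α-successor
-- of s therefore amounts to walking simultaneously in M and in Ω through agents of C,
-- passing Pre at every intermediate state, until ⟨αₖ⟩φ holds.  Excluded middle turns the
-- negated universals of ⟨_⟩ and ◇* into witnesses.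
module Submission where

open import Defs
open import Level using (0ℓ)
open import Axiom.ExcludedMiddle using (ExcludedMiddle)
open import Axiom.DoubleNegationElimination using (em⇒dne)
open import Data.Nat using (ℕ; zero; suc)
open import Data.Fin using (Fin; zero; suc; inject₁; fromℕ)
open import Data.Fin.Properties using (∀-cons)
open import Data.Vec using (Vec; _∷_; lookup)
open import Data.Vec.Functional using () renaming (_∷_ to _◂_)
open import Data.Product using (Σ; ∃; _×_; _,_)
open import Data.Unit using (tt)
open import Data.Empty using (⊥-elim)
open import Relation.Nullary using (¬_)
open import Relation.Binary.PropositionalEquality using (_≡_; refl; sym; trans; cong; subst)
open import Relation.Binary.Construct.Closure.ReflexiveTransitive using (Star; ε; _◅_)
open import Function.Base using (_∘_)
open import Function.Bundles using (_⇔_; mk⇔)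
open import Function.Construct.Composition using (_⇔-∘_)

module ProductUpdate (AtSen Agents : Set) (Sig : Signature Agents) where

  open Signature Sig
  open Logic AtSen Agents Sig

  ⟦⟧ⱽ⇒⟦lookup⟧ : ∀ {m} (ψs : Vec Sentence m) i {M s} → ⟦ ψs ⟧ⱽ M i s → ⟦ lookup ψs i ⟧ M s
  ⟦⟧ⱽ⇒⟦lookup⟧ (_ ∷ ψs) zero    p = p
  ⟦⟧ⱽ⇒⟦lookup⟧ (_ ∷ ψs) (suc i) p = ⟦⟧ⱽ⇒⟦lookup⟧ ψs i p

  ⟦lookup⟧⇒⟦⟧ⱽ : ∀ {m} (ψs : Vec Sentence m) i {M s} → ⟦ lookup ψs i ⟧ M s → ⟦ ψs ⟧ⱽ M i s
  ⟦lookup⟧⇒⟦⟧ⱽ (_ ∷ ψs) zero    p = p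
  ⟦lookup⟧⇒⟦⟧ⱽ (_ ∷ ψs) (suc i) p = ⟦lookup⟧⇒⟦⟧ⱽ ψs i p

  cast : {M N : Model} → M ≡ N → St M → St N
  cast = subst St

  -- By K, identifications of models are unique, so any two composites of casts agree.
  cast-cast : {L M N : Model} (p : L ≡ M) (q : M ≡ N) (r : L ≡ N) {x : St L} →
              cast q (cast p x) ≡ cast r x
  cast-cast refl refl refl = refl

  cast₁ : (P : (M : Model) → St M → Set) {M N : Model} (e : M ≡ N) {x : St M} →
          P M x → P N (cast e x)
  cast₁ P refl p = p

  cast₂ : (P : (M : Model) → St M → St M → Set) {M N : Model} (e : M ≡ N) {x y : St M} →
          P M x y → P N (cast e x) (cast e y)
  cast₂ P refl p = p

  rel-cast : (π : Program) {L N N′ : Model} (e : N ≡ N′)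
             (p : L ≡ N ⟪ π ⟫) (q : L ≡ N′ ⟪ π ⟫) {m : St N} {y : St L} →
             rel π N m (cast p y) → rel π N′ (cast e m) (cast q y)
  rel-cast π refl refl refl r = r

  rel⇒Pre : ∀ α {M s t} → rel ⌜ α ⌝ M s t → ⟦ Pre α ⟧ M s
  rel⇒Pre skip       _                    = tt
  rel⇒Pre crash      ()
  rel⇒Pre (act i ψs) {t = _ , p} (refl , refl) = ⟦⟧ⱽ⇒⟦lookup⟧ ψs i p
  rel⇒Pre (α ⨾ β)    (m , r₁ , r₂)        = λ ¬pre → ¬pre m r₁ (rel⇒Pre β r₂)

  -- The updated model sees only the preconditions of an action, not its action types.
  ⟶Ω⇒≡⟪⟫ : ∀ {A α α′} → α ⟶Ω[ A ] α′ → (M : Model) → M ⟪ ⌜ α ⌝ ⟫ ≡ M ⟪ ⌜ α′ ⌝ ⟫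
  ⟶Ω⇒≡⟪⟫ skip    M = refl
  ⟶Ω⇒≡⟪⟫ (act _) M = refl
  ⟶Ω⇒≡⟪⟫ (seq {β = β} a b) M = trans (cong (_⟪ ⌜ β ⌝ ⟫) (⟶Ω⇒≡⟪⟫ a M)) (⟶Ω⇒≡⟪⟫ b _)

  R⟪⟫⇒R×⟶Ω : ∀ α {M s t t′ A} → rel ⌜ α ⌝ M s t → R (M ⟪ ⌜ α ⌝ ⟫) A t t′ →
             Σ (St M) λ s′ → Σ SAction λ α′ → Σ (α ⟶Ω[ A ] α′) λ st →
               R M A s s′ × rel ⌜ α′ ⌝ M s′ (cast (⟶Ω⇒≡⟪⟫ st M) t′)
  R⟪⟫⇒R×⟶Ω skip refl r = _ , skip , skip , r , refl
  R⟪⟫⇒R×⟶Ω crash ()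
  R⟪⟫⇒R×⟶Ω (act i ψs) {t′ = (s′ , j) , _} (refl , refl) (r , i⟶j) =
    s′ , act j ψs , act i⟶j , r , refl , refl
  R⟪⟫⇒R×⟶Ω (α ⨾ β) {M} (_ , r₁ , r₂) r =
    let _ , β′ , β⟶β′ , rₘ , r₂′ = R⟪⟫⇒R×⟶Ω β r₂ r
        s′ , α′ , α⟶α′ , rₛ , r₁′ = R⟪⟫⇒R×⟶Ω α r₁ rₘ
        st = seq α⟶α′ β⟶β′
    in s′ , α′ ⨾ β′ , st , rₛ , _ , r₁′ ,
       rel-cast ⌜ β′ ⌝ (⟶Ω⇒≡⟪⟫ α⟶α′ M) (⟶Ω⇒≡⟪⟫ β⟶β′ _) (⟶Ω⇒≡⟪⟫ st M) r₂′

  R×⟶Ω⇒R⟪⟫ : ∀ {α α′ A M s s′ t t′} (st : α ⟶Ω[ A ] α′) →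
             rel ⌜ α ⌝ M s t → rel ⌜ α′ ⌝ M s′ (cast (⟶Ω⇒≡⟪⟫ st M) t′) → R M A s s′ →
             R (M ⟪ ⌜ α ⌝ ⟫) A t t′
  R×⟶Ω⇒R⟪⟫ skip refl refl r = r
  R×⟶Ω⇒R⟪⟫ (act i⟶j) (refl , refl) (refl , refl) r = r , i⟶j
  R×⟶Ω⇒R⟪⟫ {α′ = α₁′ ⨾ β′} {M = M} {s′ = s′} st@(seq α⟶α′ β⟶β′)
            (_ , r₁ , r₂) (_ , r₁′ , r₂′) r =
    R×⟶Ω⇒R⟪⟫ β⟶β′ r₂
      (rel-cast ⌜ β′ ⌝ (sym eₐ) (⟶Ω⇒≡⟪⟫ st M) (⟶Ω⇒≡⟪⟫ β⟶β′ _) r₂′)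
      (R×⟶Ω⇒R⟪⟫ α⟶α′ r₁ r₁″ r)
    where
      eₐ = ⟶Ω⇒≡⟪⟫ α⟶α′ M
      r₁″ = subst (rel ⌜ α₁′ ⌝ M s′) (sym (cast-cast (sym eₐ) eₐ refl)) r₁′

  module Runs (C : Agents → Set) (φ : Sentence) (M : Model) where

    data Run : St M → SAction → Set₁ where
      done : ∀ {s α} → ⟦ ⟨ ⌜ α ⌝ ⟩ φ ⟧ M s → Run s α
      step : ∀ {s s′ α α′ A} → C A → R M A s s′ → α ⟶Ω[ A ] α′ → ⟦ Pre α ⟧ M s →
             Run s′ α′ → Run s α

    -- The path is taken in a model N merely equal to M⟪α⟫, so that it stays structurally
    -- smaller when α changes along the run.
    path⇒Run : ∀ {α s N t u} (e : N ≡ M ⟪ ⌜ α ⌝ ⟫) → rel ⌜ α ⌝ M s (cast e t) →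
               Star (reach N C) t u → ⟦ φ ⟧ N u → Run s α
    path⇒Run e r ε φu = done λ ¬⟨⟩φ → ¬⟨⟩φ _ r (cast₁ ⟦ φ ⟧ e φu)
    path⇒Run {α} e r ((A , cA , r₁) ◅ path) φu =
      let s′ , α′ , st , rₛ , r′ = R⟪⟫⇒R×⟶Ω α r (cast₂ (λ N → R N A) e r₁)
          e′ = trans e (⟶Ω⇒≡⟪⟫ st M)
      in step cA rₛ st (rel⇒Pre α r)
           (path⇒Run e′ (subst (rel ⌜ α′ ⌝ M s′) (cast-cast e (⟶Ω⇒≡⟪⟫ st M) e′) r′) path φu)

    Path : St M → SAction → Set
    Path s α = ∃ λ t → rel ⌜ α ⌝ M s t ×
               ∃ λ u → Star (reach (M ⟪ ⌜ α ⌝ ⟫) C) t u × ⟦ φ ⟧ (M ⟪ ⌜ α ⌝ ⟫) u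

    Path⇒⟨⟩◇* : ∀ {s α} → Path s α → ⟦ ⟨ ⌜ α ⌝ ⟩ (◇* C φ) ⟧ M s
    Path⇒⟨⟩◇* (t , r , u , path , φu) ¬⟨⟩◇* = ¬⟨⟩◇* t r λ □¬ → □¬ u path φu

    module Classical (em : ExcludedMiddle 0ℓ) where

      ¬∀¬⇒∃ : {X : Set} {P Q : X → Set} → ¬ (∀ x → P x → ¬ Q x) → ∃ λ x → P x × Q x
      ¬∀¬⇒∃ h = em⇒dne em λ ¬∃ → h λ x p q → ¬∃ (x , p , q)

      Pre⇒rel : ∀ α {N s} → ⟦ Pre α ⟧ N s → ∃ (rel ⌜ α ⌝ N s)
      Pre⇒rel skip       _     = _ , refl
      Pre⇒rel crash      ¬true = ⊥-elim (¬true tt)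
      Pre⇒rel (act i ψs) {s = s} p = ((s , i) , ⟦lookup⟧⇒⟦⟧ⱽ ψs i p) , refl , refl
      Pre⇒rel (α ⨾ β)    p     =
        let m , r₁ , pre = ¬∀¬⇒∃ p
            t , r₂ = Pre⇒rel β pre
        in t , m , r₁ , r₂

      ⟨⟩◇*⇒Run : ∀ {s α} → ⟦ ⟨ ⌜ α ⌝ ⟩ (◇* C φ) ⟧ M s → Run s α
      ⟨⟩◇*⇒Run h =
        let t , r , ◇φ = ¬∀¬⇒∃ h
            u , path , φu = ¬∀¬⇒∃ ◇φ
        in path⇒Run refl r path φu

      Run⇒Path : ∀ {s α} → Run s α → Path s α
      Run⇒Path (done ⟨⟩φ) = let t , r , φt = ¬∀¬⇒∃ ⟨⟩φ in t , r , t , ε , φt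
      Run⇒Path {α = α} (step {s′ = s′} {α′ = α′} {A = A} cA rₛ st pre run) =
        let _ , r′ , u′ , path , φu′ = Run⇒Path run
            t , r = Pre⇒rel α pre
            e = sym (⟶Ω⇒≡⟪⟫ st M)
            r″ = subst (rel ⌜ α′ ⌝ M s′) (sym (cast-cast e (⟶Ω⇒≡⟪⟫ st M) refl)) r′
        in t , r , cast e u′ ,
           (A , cA , R×⟶Ω⇒R⟪⟫ st r r″ rₛ) ◅ cast₂ (λ N → Star (reach N C)) e path ,
           cast₁ ⟦ φ ⟧ e φu′

      ⟨⟩◇*⇔Run : ∀ {s α} → ⟦ ⟨ ⌜ α ⌝ ⟩ (◇* C φ) ⟧ M s ⇔ Run s α
      ⟨⟩◇*⇔Run {s} {α} = mk⇔ (⟨⟩◇*⇒Run {s} {α}) (Path⇒⟨⟩◇* {s} {α} ∘ Run⇒Path)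

    RunSequence : St M → SAction → Set₁
    RunSequence s α =
      Σ ℕ λ k → Σ (Fin k → Agents) λ As → Σ (Fin (suc k) → St M) λ ss →
      Σ (Fin (suc k) → SAction) λ αs →
        (∀ i → C (As i))
        × ss zero ≡ s
        × (∀ i → R M (As i) (ss (inject₁ i)) (ss (suc i)))
        × αs zero ≡ α
        × (∀ i → αs (inject₁ i) ⟶Ω[ As i ] αs (suc i))
        × (∀ i → ⟦ Pre (αs (inject₁ i)) ⟧ M (ss (inject₁ i)))
        × ⟦ ⟨ ⌜ αs (fromℕ k) ⌝ ⟩ φ ⟧ M (ss (fromℕ k))

    Run⇒RunSequence : ∀ {s α} → Run s α → RunSequence s α
    Run⇒RunSequence {s} {α} (done ⟨⟩φ) =
      0 , (λ ()) , (λ _ → s) , (λ _ → α) , (λ ()) , refl , (λ ()) , refl , (λ ()) , (λ ()) , ⟨⟩φ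
    Run⇒RunSequence {s} {α} (step {A = A} cA rₛ st pre run)
      with Run⇒RunSequence run
    ... | k , As , ss , αs , cAs , refl , rs , refl , sts , pres , ⟨⟩φ =
      suc k , A ◂ As , s ◂ ss , α ◂ αs , ∀-cons cA cAs , refl , ∀-cons rₛ rs , refl ,
      ∀-cons st sts , ∀-cons pre pres , ⟨⟩φ

    sequences⇒Run : ∀ k (As : Fin k → Agents) (ss : Fin (suc k) → St M)
                      (αs : Fin (suc k) → SAction) →
      (∀ i → C (As i)) →
      (∀ i → R M (As i) (ss (inject₁ i)) (ss (suc i))) →
      (∀ i → αs (inject₁ i) ⟶Ω[ As i ] αs (suc i)) →
      (∀ i → ⟦ Pre (αs (inject₁ i)) ⟧ M (ss (inject₁ i))) →
      ⟦ ⟨ ⌜ αs (fromℕ k) ⌝ ⟩ φ ⟧ M (ss (fromℕ k)) →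
      Run (ss zero) (αs zero)
    sequences⇒Run zero    _  _  _  _   _  _   _    ⟨⟩φ = done ⟨⟩φ
    sequences⇒Run (suc k) As ss αs cAs rs sts pres ⟨⟩φ =
      step (cAs zero) (rs zero) (sts zero) (pres zero)
        (sequences⇒Run k (As ∘ suc) (ss ∘ suc) (αs ∘ suc) (cAs ∘ suc) (rs ∘ suc) (sts ∘ suc)
          (pres ∘ suc) ⟨⟩φ)

    RunSequence⇒Run : ∀ {s α} → RunSequence s α → Run s α
    RunSequence⇒Run (k , As , ss , αs , cAs , refl , rs , refl , sts , pres , ⟨⟩φ) =
      sequences⇒Run k As ss αs cAs rs sts pres ⟨⟩φ

    Run⇔RunSequence : ∀ {s α} → Run s α ⇔ RunSequence s α
    Run⇔RunSequence = mk⇔ Run⇒RunSequence RunSequence⇒Run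

mainTheorem9 : (AtSen Agents : Set) (Sig : Signature Agents) → ExcludedMiddle 0ℓ →
    let open Logic AtSen Agents Sig in
    (α : SAction) (C : Agents → Set) (φ : Sentence) (M : Model) (s : St M) →
    (⟦ ⟨ ⌜ α ⌝ ⟩ (◇* C φ) ⟧ M s
      ⇔ Σ ℕ (λ k →
        Σ (Fin k → Agents) (λ As →
        Σ (Fin (suc k) → St M) (λ ss →
        Σ (Fin (suc k) → SAction) (λ αs →
          (∀ i → C (As i))
          × ss zero ≡ s
          × (∀ i → R M (As i) (ss (inject₁ i)) (ss (suc i)))
          × αs zero ≡ α
          × (∀ i → αs (inject₁ i) ⟶Ω[ As i ] αs (suc i))
          × (∀ i → ⟦ Pre (αs (inject₁ i)) ⟧ M (ss (inject₁ i)))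
          × ⟦ ⟨ ⌜ αs (fromℕ k) ⌝ ⟩ φ ⟧ M (ss (fromℕ k)))))))
mainTheorem9 AtSen Agents Sig em α C φ M s =
  Run⇔RunSequence ⇔-∘ Classical.⟨⟩◇*⇔Run em
  where open ProductUpdate.Runs AtSen Agents Sig C φ M
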